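{- Let $\rho$ be a finite-dimensional representation of $\mathrm{SL}_2(\mathbb{Z})$ and $M$ a positive integer. If $\ker\rho$ has finite index in $\mathrm{SL}_2(\mathbb{Z})$, then $\ker(T_M\rho)$ has finite index. If $\ker\rho$ is a congruence subgroup, then so is $\ker(T_M\rho)$.
   Context: $\Delta_M=\{\begin{pmatrix}a&b\\0&d\end{pmatrix}\in M_2(\mathbb{Z}):a,d>0,ad=M,0\le b<d\}$; each integer matrix $x$ of determinant $M$ is uniquely $x=\gamma'\overline x$ with $\gamma'\in\mathrm{SL}_2(\mathbb{Z})$, $\overline x\in\Delta_M$; for $m\in\Delta_M$, $\gamma\in\mathrm{SL}_2(\mathbb{Z})$, $I_m(\gamma)$ is defined by $m\gamma=I_m(\gamma)\overline{m\gamma}$. $T_M\rho$ is the representation on $V(\rho)\otimes\mathbb{C}[\Delta_M]$ with $(T_M\rho)(\gamma)(v\otimes\mathfrak{e}_m)=\rho(I_m(\gamma^{ -1}))^{ -1}v\otimes\mathfrak{e}_{\overline{m\gamma^{ -1}}}$. A congruence subgroup is a subgroup containing some principal congruence subgroup $\Gamma(N)=\{\gamma\equiv I_2\bmod N\}$. -}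

module Defs where

open import Level using (Level; _⊔_) renaming (suc to lsuc)
open import Data.Nat as ℕ using (ℕ)
open import Data.Integer as ℤ using (ℤ; +_; _+_; _*_; -_; _-_)
open import Data.Integer.Divisibility using (_∣_)
open import Data.Integer.Solver using (module +-*-Solver)
open import Data.Fin using (Fin)
open import Data.List using (List)
open import Data.List.Membership.Propositional using (_∈_)
open import Data.Product using (Σ; ∃; _×_; _,_; proj₁; proj₂)
open import Relation.Nullary using (Dec; yes; no)
open import Relation.Binary.PropositionalEquality
open import Algebra.Bundles using (CommutativeRing)
open import Algebra.Module.Bundles using (LeftModule)

record Mat : Set where
  constructor mat
  field
    a b c d : ℤ
open Mat

infixl 7 _·_
_·_ : Mat → Mat → Mat
x · y = mat (a x * a y + b x * c y) (a x * b y + b x * d y)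
            (c x * a y + d x * c y) (c x * b y + d x * d y)

det : Mat → ℤ
det x = a x * d x - b x * c x

adj : Mat → Mat
adj x = mat (d x) (- b x) (- c x) (a x)

I₂ : Mat
I₂ = mat (+ 1) (+ 0) (+ 0) (+ 1)

det-· : ∀ x y → det (x · y) ≡ det x * det y
det-· (mat a₁ b₁ c₁ d₁) (mat a₂ b₂ c₂ d₂) =
  solve 8 (λ a₁ b₁ c₁ d₁ a₂ b₂ c₂ d₂ →
    (a₁ :* a₂ :+ b₁ :* c₂) :* (c₁ :* b₂ :+ d₁ :* d₂)
      :- (a₁ :* b₂ :+ b₁ :* d₂) :* (c₁ :* a₂ :+ d₁ :* c₂)
    := (a₁ :* d₁ :- b₁ :* c₁) :* (a₂ :* d₂ :- b₂ :* c₂))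
    refl a₁ b₁ c₁ d₁ a₂ b₂ c₂ d₂
  where open +-*-Solver

det-adj : ∀ x → det (adj x) ≡ det x
det-adj (mat a₁ b₁ c₁ d₁) =
  solve 4 (λ a₁ b₁ c₁ d₁ → d₁ :* a₁ :- (:- b₁) :* (:- c₁) := a₁ :* d₁ :- b₁ :* c₁)
    refl a₁ b₁ c₁ d₁
  where open +-*-Solver

record SL2Z : Set where
  constructor sl
  field
    m   : Mat
    det≡1 : det m ≡ + 1
open SL2Z public using () renaming (m to ⟦_⟧)

_≈S_ : SL2Z → SL2Z → Set
γ ≈S δ = ⟦ γ ⟧ ≡ ⟦ δ ⟧

1S : SL2Z
1S = sl I₂ refl

_∘S_ : SL2Z → SL2Z → SL2Z
sl x px ∘S sl y py = sl (x · y) (trans (det-· x y) (cong₂ _*_ px py))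

invS : SL2Z → SL2Z
invS (sl x px) = sl (adj x) (trans (det-adj x) px)

FiniteIndex : ∀ {ℓ} → (SL2Z → Set ℓ) → Set ℓ
FiniteIndex H = Σ (List SL2Z) λ gs → ∀ γ → Σ SL2Z λ g → g ∈ gs × H (invS g ∘S γ)

InΓ : ℕ → SL2Z → Set
InΓ N γ = (+ N ∣ (a ⟦ γ ⟧ - + 1)) × (+ N ∣ b ⟦ γ ⟧) × (+ N ∣ c ⟦ γ ⟧) × (+ N ∣ (d ⟦ γ ⟧ - + 1))

IsCongruence : ∀ {ℓ} → (SL2Z → Set ℓ) → Set ℓ
IsCongruence H = Σ ℕ λ N → (1 ℕ.≤ N) × (∀ γ → InΓ N γ → H γ)

record Δ (M : ℕ) : Set where
  constructor δ
  field
    a' b' d' : ℕ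
    ad≡M : a' ℕ.* d' ≡ M
    0<a : 0 ℕ.< a'
    0<d : 0 ℕ.< d'
    b<d : b' ℕ.< d'
open Δ public

toMat : ∀ {M} → Δ M → Mat
toMat m = mat (+ a' m) (+ b' m) (+ 0) (+ d' m)

_≈Δ_ : ∀ {M} → Δ M → Δ M → Set
m ≈Δ n = (a' m ≡ a' n) × (b' m ≡ b' n) × (d' m ≡ d' n)

_≟Δ_ : ∀ {M} (m n : Δ M) → Dec (m ≈Δ n)
m ≟Δ n with a' m ℕ.≟ a' n | b' m ℕ.≟ b' n | d' m ℕ.≟ d' n
... | yes p | yes q | yes r = yes (p , q , r)
... | no ¬p | _ | _ = no λ z → ¬p (proj₁ z)
... | yes _ | no ¬q | _ = no λ z → ¬q (proj₁ (proj₂ z))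
... | yes _ | yes _ | no ¬r = no λ z → ¬r (proj₂ (proj₂ z))

-- The decomposition m γ = I_m(γ) · \overline{mγ} (γ' ∈ SL₂(ℤ), \overline{mγ} ∈ Δ_M).
-- Since this decomposition is unique, any function with this specification
-- is THE map (m, γ) ↦ (I_m(γ), \overline{mγ}).
record Decomposition (M : ℕ) : Set where
  field
    I    : Δ M → SL2Z → SL2Z
    bar  : Δ M → SL2Z → Δ M
    spec : ∀ m γ → toMat m · ⟦ γ ⟧ ≡ ⟦ I m γ ⟧ · toMat (bar m γ)

module _ {c ℓ} (R : CommutativeRing c ℓ) where
  open CommutativeRing R using (ring) renaming (Carrier to K)

  record Rep {m ℓm} (V : LeftModule ring m ℓm) : Set (c ⊔ m ⊔ ℓm) where
    open LeftModule V
    field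
      act     : SL2Z → Carrierᴹ → Carrierᴹ
      act-cong : ∀ γ {u v} → u ≈ᴹ v → act γ u ≈ᴹ act γ v
      act-+   : ∀ γ u v → act γ (u +ᴹ v) ≈ᴹ act γ u +ᴹ act γ v
      act-*   : ∀ γ (r : K) v → act γ (r *ₗ v) ≈ᴹ r *ₗ act γ v
      act-1   : ∀ v → act 1S v ≈ᴹ v
      act-∘   : ∀ γ δ v → act (γ ∘S δ) v ≈ᴹ act γ (act δ v)
      act-≈S  : ∀ {γ δ} v → γ ≈S δ → act γ v ≈ᴹ act δ v

  FinDim : ∀ {m ℓm} → LeftModule ring m ℓm → Set (c ⊔ m ⊔ ℓm)
  FinDim V = Σ ℕ λ n → Σ (Fin n → Carrierᴹ) λ e →
               ∀ v → Σ (Fin n → K) λ r → v ≈ᴹ lin n r e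
    where
    open LeftModule V
    lin : (n : ℕ) → (Fin n → K) → (Fin n → Carrierᴹ) → Carrierᴹ
    lin ℕ.zero r e = 0ᴹ
    lin (ℕ.suc n) r e = (r Fin.zero *ₗ e Fin.zero) +ᴹ lin n (λ i → r (Fin.suc i)) (λ i → e (Fin.suc i))
      where import Data.Fin as Fin

  module _ {m ℓm} {V : LeftModule ring m ℓm} (ρ : Rep V) where
    open LeftModule V
    open Rep ρ

    ker : SL2Z → Set (m ⊔ ℓm)
    ker γ = ∀ v → act γ v ≈ᴹ v

    -- V ⊗ ℂ[Δ_M] ≅ ⊕_{m ∈ Δ_M} V, realised as functions Δ_M → V
    Tensor : ℕ → Set m
    Tensor M = Δ M → Carrierᴹ

    _⊗e_ : ∀ {M} → Carrierᴹ → Δ M → Tensor M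
    (v ⊗e m) n with n ≟Δ m
    ... | yes _ = v
    ... | no _  = 0ᴹ

    _≈T_ : ∀ {M} → Tensor M → Tensor M → Set (ℓm)
    F ≈T G = ∀ n → F n ≈ᴹ G n

    -- (T_M ρ)(γ)(v ⊗ 𝔢_m) = ρ(I_m(γ⁻¹))⁻¹ v ⊗ 𝔢_{\overline{m γ⁻¹}}
    -- (ρ(g)⁻¹ is realised as ρ(g⁻¹))
    T-basis : ∀ {M} → Decomposition M → SL2Z → Carrierᴹ → Δ M → Tensor M
    T-basis D γ v m =
      act (invS (Decomposition.I D m (invS γ))) v ⊗e Decomposition.bar D m (invS γ)

    -- ker(T_M ρ): γ acting trivially on V ⊗ ℂ[Δ_M]; by linearity it suffices
    -- (and is necessary) that γ fixes every pure tensor v ⊗ 𝔢_m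
    kerT : ∀ {M} → Decomposition M → SL2Z → Set (m ⊔ ℓm)
    kerT D γ = ∀ v m → T-basis D γ v m ≈T (v ⊗e m)

-- If m γ⁻¹ = J m with J ∈ ker ρ for every m ∈ Δ_M, uniqueness of the decomposition gives
-- I_m(γ⁻¹) = J and \overline{mγ⁻¹} = m, so T_M ρ(γ) fixes every v ⊗ 𝔢_m: ker T_M ρ contains
-- Γ' = ⋂_{m ∈ Δ_M} m⁻¹ (ker ρ) m.  Since adj m · m = M, m (1 + N M X) = (1 + N · m X adj m) m, so
-- Γ(N M) ⊆ Γ' whenever Γ(N) ⊆ ker ρ.  For finite index, SL₂(ℤ) acts on the finite set of maps
-- Δ_M → Δ_M × SL₂(ℤ)/ker ρ, m ↦ (\overline{mβ}, I_m(β) ker ρ), and elements with the same image differ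
-- by an element of Γ'.  Membership in ker ρ is undecidable, so this image is tracked by a finite automaton
-- reading words in the generators S, T, T⁻¹; by pigeonhole every state is reached by a word of bounded
-- length, and the finitely many such words give coset representatives of Γ'.

module Submission where

open import Defs
open import Level using (_⊔_; 0ℓ)
open import Data.Nat as ℕ using (ℕ; zero; suc; z≤n; s≤s; _∸_; _<_)
import Data.Nat.Properties as ℕP
open import Data.Integer as ℤ using (ℤ; +_; _+_; _*_; -_; _-_; +[1+_]; -[1+_])
import Data.Integer.Properties as ℤP
open import Data.Integer.DivMod using (_/_; _%_; n%d<d; a≡a%n+[a/n]*n)
open import Data.Integer.Divisibility.Signed using (divides; ∣ᵤ⇒∣; ∣⇒∣ᵤ)
open import Data.Integer.Solver using (module +-*-Solver)
open import Data.Fin as Fin using (Fin; toℕ; combine)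
import Data.Fin.Properties as FinP
open import Data.List as List using (List; []; _∷_; _++_; length; take; drop; foldl; map; replicate; upTo;
                                     cartesianProduct; cartesianProductWith)
import Data.List.Properties as ListP
open import Data.List.Membership.Propositional using (_∈_)
open import Data.List.Membership.Propositional.Properties
  using (∈-map⁺; ∈-upTo⁺; ∈-cartesianProduct⁺; ∈-cartesianProductWith⁺)
open import Data.List.Relation.Unary.Any as Any using (here; there)
open import Data.List.Relation.Unary.Any.Properties using (lookup-index)
open import Data.Vec as Vec using (Vec; []; _∷_)
import Data.Vec.Properties as VecP
open import Data.Product using (Σ; _×_; _,_; proj₁; proj₂)
open import Data.Sum using (inj₁; inj₂)
open import Data.Empty using (⊥; ⊥-elim)
open import Function.Bundles using (_↣_; mk↣; Injection)
open import Relation.Nullary using (yes; no; contradiction)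
open import Relation.Binary.PropositionalEquality hiding (J)
open import Algebra.Bundles using (Group; CommutativeRing)
open import Algebra.Structures using (IsGroup)
import Algebra.Properties.Group as GroupProperties
open import Algebra.Module.Bundles using (LeftModule)

open Mat
open +-*-Solver using (solve; _:=_; con; _:+_; _:*_; _:-_; :-_)

module _ {c ℓ} (G : Group c ℓ) where
  open Group G
  open import Algebra.Properties.Group G using (\\-leftDividesˡ; ⁻¹-anti-homo-∙; ⁻¹-involutive)
  open import Relation.Binary.Reasoning.Setoid (Group.setoid G)

  record IsNormalSubgroup {p} (H : Carrier → Set p) : Set (c ⊔ ℓ ⊔ p) where
    field
      resp-≈      : ∀ {x y} → x ≈ y → H x → H y
      ∙-closed    : ∀ {x y} → H x → H y → H (x ∙ y)
      ⁻¹-closed   : ∀ {x} → H x → H (x ⁻¹)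
      conj-closed : ∀ g {h} → H h → H (g \\ (h ∙ g))

    coset-∙ʳ : ∀ r r′ x j → H (r \\ x) → H (r′ \\ (r ∙ j)) → H (r′ \\ (x ∙ j))
    coset-∙ʳ r r′ x j x∈rH rj∈r′H = resp-≈ eq (∙-closed rj∈r′H (conj-closed j x∈rH))
      where
      eq : (r′ \\ (r ∙ j)) ∙ (j \\ ((r \\ x) ∙ j)) ≈ r′ \\ (x ∙ j)
      eq = begin
        r′ ⁻¹ ∙ (r ∙ j) ∙ (j ⁻¹ ∙ (r ⁻¹ ∙ x ∙ j))   ≈⟨ assoc _ _ _ ⟩
        r′ ⁻¹ ∙ (r ∙ j ∙ (j ⁻¹ ∙ (r ⁻¹ ∙ x ∙ j)))   ≈⟨ ∙-congˡ (assoc _ _ _) ⟩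
        r′ ⁻¹ ∙ (r ∙ (j ∙ (j ⁻¹ ∙ (r ⁻¹ ∙ x ∙ j)))) ≈⟨ ∙-congˡ (∙-congˡ (\\-leftDividesˡ j _)) ⟩
        r′ ⁻¹ ∙ (r ∙ (r ⁻¹ ∙ x ∙ j))                ≈⟨ ∙-congˡ (∙-congˡ (assoc _ _ _)) ⟩
        r′ ⁻¹ ∙ (r ∙ (r ⁻¹ ∙ (x ∙ j)))              ≈⟨ ∙-congˡ (\\-leftDividesˡ r _) ⟩
        r′ ⁻¹ ∙ (x ∙ j) ∎

    same-coset : ∀ r x y → H (r \\ x) → H (r \\ y) → H (x ∙ y ⁻¹)
    same-coset r x y x∈rH y∈rH =
      resp-≈ eq (conj-closed (r ⁻¹) (∙-closed x∈rH (⁻¹-closed y∈rH)))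
      where
      eq : r ⁻¹ \\ ((r \\ x) ∙ (r \\ y) ⁻¹ ∙ r ⁻¹) ≈ x ∙ y ⁻¹
      eq = begin
        r ⁻¹ ⁻¹ ∙ (r ⁻¹ ∙ x ∙ (r ⁻¹ ∙ y) ⁻¹ ∙ r ⁻¹) ≈⟨ ∙-cong (⁻¹-involutive r) (∙-congʳ (∙-congˡ (⁻¹-anti-homo-∙ _ _))) ⟩
        r ∙ (r ⁻¹ ∙ x ∙ (y ⁻¹ ∙ r ⁻¹ ⁻¹) ∙ r ⁻¹)    ≈⟨ ∙-congˡ (∙-congʳ (∙-congˡ (∙-congˡ (⁻¹-involutive r)))) ⟩
        r ∙ (r ⁻¹ ∙ x ∙ (y ⁻¹ ∙ r) ∙ r ⁻¹)          ≈⟨ ∙-congˡ (assoc _ _ _) ⟩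
        r ∙ (r ⁻¹ ∙ x ∙ (y ⁻¹ ∙ r ∙ r ⁻¹))          ≈⟨ ∙-congˡ (∙-congˡ (assoc _ _ _)) ⟩
        r ∙ (r ⁻¹ ∙ x ∙ (y ⁻¹ ∙ (r ∙ r ⁻¹)))        ≈⟨ ∙-congˡ (∙-congˡ (∙-congˡ (inverseʳ r))) ⟩
        r ∙ (r ⁻¹ ∙ x ∙ (y ⁻¹ ∙ ε))                 ≈⟨ ∙-congˡ (∙-congˡ (identityʳ _)) ⟩
        r ∙ (r ⁻¹ ∙ x ∙ y ⁻¹)                       ≈⟨ ∙-congˡ (assoc _ _ _) ⟩
        r ∙ (r ⁻¹ ∙ (x ∙ y ⁻¹))                     ≈⟨ \\-leftDividesˡ r _ ⟩
        x ∙ y ⁻¹ ∎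

mat-cong : ∀ {a b c d a′ b′ c′ d′} → a ≡ a′ → b ≡ b′ → c ≡ c′ → d ≡ d′ →
           mat a b c d ≡ mat a′ b′ c′ d′
mat-cong refl refl refl refl = refl

·-assoc : ∀ x y z → (x · y) · z ≡ x · (y · z)
·-assoc (mat a₁ b₁ c₁ d₁) (mat a₂ b₂ c₂ d₂) (mat a₃ b₃ c₃ d₃) =
  mat-cong (entry a₁ b₁ a₃ c₃) (entry a₁ b₁ b₃ d₃) (entry c₁ d₁ a₃ c₃) (entry c₁ d₁ b₃ d₃)
  where
  entry : ∀ x y z w → (x * a₂ + y * c₂) * z + (x * b₂ + y * d₂) * w
                    ≡ x * (a₂ * z + b₂ * w) + y * (c₂ * z + d₂ * w)
  entry x y z w = solve 8 (λ x y z w a b c d →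
    (x :* a :+ y :* c) :* z :+ (x :* b :+ y :* d) :* w := x :* (a :* z :+ b :* w) :+ y :* (c :* z :+ d :* w))
    refl x y z w a₂ b₂ c₂ d₂

·-identityˡ : ∀ x → I₂ · x ≡ x
·-identityˡ (mat a b c d) = mat-cong (entry a c) (entry b d) (entry′ a c) (entry′ b d)
  where
  entry : ∀ x y → + 1 * x + + 0 * y ≡ x
  entry = solve 2 (λ x y → con (+ 1) :* x :+ con (+ 0) :* y := x) refl
  entry′ : ∀ x y → + 0 * x + + 1 * y ≡ y
  entry′ = solve 2 (λ x y → con (+ 0) :* x :+ con (+ 1) :* y := y) refl

·-identityʳ : ∀ x → x · I₂ ≡ x
·-identityʳ (mat a b c d) = mat-cong (entry a b) (entry′ a b) (entry c d) (entry′ c d)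
  where
  entry : ∀ x y → x * + 1 + y * + 0 ≡ x
  entry = solve 2 (λ x y → x :* con (+ 1) :+ y :* con (+ 0) := x) refl
  entry′ : ∀ x y → x * + 0 + y * + 1 ≡ y
  entry′ = solve 2 (λ x y → x :* con (+ 0) :+ y :* con (+ 1) := y) refl

adj-inverseˡ : ∀ x → det x ≡ + 1 → adj x · x ≡ I₂
adj-inverseˡ (mat a b c d) det≡1 = mat-cong
  (trans (solve 4 (λ a b c d → d :* a :+ (:- b) :* c := a :* d :- b :* c) refl a b c d) det≡1)
  (solve 2 (λ b d → d :* b :+ (:- b) :* d := con (+ 0)) refl b d)
  (solve 2 (λ a c → (:- c) :* a :+ a :* c := con (+ 0)) refl a c)
  (trans (solve 4 (λ a b c d → (:- c) :* b :+ a :* d := a :* d :- b :* c) refl a b c d) det≡1)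

adj-inverseʳ : ∀ x → det x ≡ + 1 → x · adj x ≡ I₂
adj-inverseʳ (mat a b c d) det≡1 = mat-cong
  (trans (solve 4 (λ a b c d → a :* d :+ b :* (:- c) := a :* d :- b :* c) refl a b c d) det≡1)
  (solve 2 (λ a b → a :* (:- b) :+ b :* a := con (+ 0)) refl a b)
  (solve 2 (λ c d → c :* d :+ d :* (:- c) := con (+ 0)) refl c d)
  (trans (solve 4 (λ a b c d → c :* (:- b) :+ d :* a := a :* d :- b :* c) refl a b c d) det≡1)

-- The group operations are opaque: comparing elements of SL2Z that agree only up to unfolding
-- would normalise their det ≡ 1 proofs, which are ring-solver terms.
opaque
  infixl 25 _∙_
  infix  26 _⁻¹

  _∙_ : SL2Z → SL2Z → SL2Z
  _∙_ = _∘S_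

  _⁻¹ : SL2Z → SL2Z
  _⁻¹ = invS

  ⟦∙⟧ : ∀ x y → ⟦ x ∙ y ⟧ ≡ ⟦ x ⟧ · ⟦ y ⟧
  ⟦∙⟧ x y = refl

  ⟦⁻¹⟧ : ∀ x → ⟦ x ⁻¹ ⟧ ≡ adj ⟦ x ⟧
  ⟦⁻¹⟧ x = refl

  SL₂ℤ-isGroup : IsGroup _≈S_ _∙_ 1S _⁻¹
  SL₂ℤ-isGroup = record
    { isMonoid = record
      { isSemigroup = record
        { isMagma = record
          { isEquivalence = record { refl = refl ; sym = sym ; trans = trans }
          ; ∙-cong = cong₂ _·_
          }
        ; assoc = λ x y z → ·-assoc ⟦ x ⟧ ⟦ y ⟧ ⟦ z ⟧
        }
      ; identity = (λ x → ·-identityˡ ⟦ x ⟧) , (λ x → ·-identityʳ ⟦ x ⟧)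
      }
    ; inverse = (λ x → adj-inverseˡ ⟦ x ⟧ (SL2Z.det≡1 x)) , (λ x → adj-inverseʳ ⟦ x ⟧ (SL2Z.det≡1 x))
    ; ⁻¹-cong = cong adj
    }

SL₂ℤ : Group 0ℓ 0ℓ
SL₂ℤ = record { isGroup = SL₂ℤ-isGroup }

open Group SL₂ℤ using (∙-congˡ; ⁻¹-cong)
open GroupProperties SL₂ℤ using (inverseʳ-unique; ⁻¹-involutive; ⁻¹-anti-homo-∙)

intertwine-inverse : ∀ u v (x y : SL2Z) → u · ⟦ x ⟧ ≡ ⟦ y ⟧ · v → adj ⟦ y ⟧ · u ≡ v · adj ⟦ x ⟧
intertwine-inverse u v x y eq = begin
  adj ⟦ y ⟧ · u                           ≡⟨ cong (adj ⟦ y ⟧ ·_) (trans (sym (·-identityʳ u)) (cong (u ·_) (sym x·x⁻¹))) ⟩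
  adj ⟦ y ⟧ · (u · (⟦ x ⟧ · adj ⟦ x ⟧))   ≡⟨ cong (adj ⟦ y ⟧ ·_) (sym (·-assoc u ⟦ x ⟧ (adj ⟦ x ⟧))) ⟩
  adj ⟦ y ⟧ · ((u · ⟦ x ⟧) · adj ⟦ x ⟧)   ≡⟨ cong (λ z → adj ⟦ y ⟧ · (z · adj ⟦ x ⟧)) eq ⟩
  adj ⟦ y ⟧ · ((⟦ y ⟧ · v) · adj ⟦ x ⟧)   ≡⟨ cong (adj ⟦ y ⟧ ·_) (·-assoc ⟦ y ⟧ v (adj ⟦ x ⟧)) ⟩
  adj ⟦ y ⟧ · (⟦ y ⟧ · (v · adj ⟦ x ⟧))   ≡⟨ sym (·-assoc (adj ⟦ y ⟧) ⟦ y ⟧ _) ⟩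
  (adj ⟦ y ⟧ · ⟦ y ⟧) · (v · adj ⟦ x ⟧)   ≡⟨ cong (_· (v · adj ⟦ x ⟧)) y⁻¹·y ⟩
  I₂ · (v · adj ⟦ x ⟧)                    ≡⟨ ·-identityˡ _ ⟩
  v · adj ⟦ x ⟧                           ∎
  where
  open ≡-Reasoning
  x·x⁻¹ : ⟦ x ⟧ · adj ⟦ x ⟧ ≡ I₂
  x·x⁻¹ = adj-inverseʳ ⟦ x ⟧ (SL2Z.det≡1 x)
  y⁻¹·y : adj ⟦ y ⟧ · ⟦ y ⟧ ≡ I₂
  y⁻¹·y = adj-inverseˡ ⟦ y ⟧ (SL2Z.det≡1 y)

toMat-injective : ∀ {M} {x y : Δ M} → toMat x ≡ toMat y → x ≡ y
toMat-injective {x = δ _ _ _ ad≡M 0<a 0<d b<d} {δ _ _ _ ad≡M′ 0<a′ 0<d′ b<d′} refl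
  rewrite ℕP.≡-irrelevant ad≡M ad≡M′ | ℕP.<-irrelevant 0<a 0<a′
        | ℕP.<-irrelevant 0<d 0<d′ | ℕP.<-irrelevant b<d b<d′ = refl

private
  +-*-zeroʳ : ∀ u v → u + v * + 0 ≡ u
  +-*-zeroʳ = solve 2 (λ u v → u :+ v :* con (+ 0) := u) refl

  -‿*-zeroʳ : ∀ u v → u - v * + 0 ≡ u
  -‿*-zeroʳ = solve 2 (λ u v → u :- v :* con (+ 0) := u) refl

  *-zeroˡ-+ : ∀ u v → + 0 * u + v ≡ v
  *-zeroˡ-+ = solve 2 (λ u v → con (+ 0) :* u :+ v := v) refl

  *-identityˡ-+ : ∀ u v → + 1 * u + v ≡ u + v
  *-identityˡ-+ = solve 2 (λ u v → con (+ 1) :* u :+ v := u :+ v) refl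

lower-left-zero : ∀ r s {a} → 0 ℕ.< a → r * + a + s * + 0 ≡ + 0 → r ≡ + 0
lower-left-zero r s 0<a eq with ℤP.i*j≡0⇒i≡0∨j≡0 r (trans (sym (+-*-zeroʳ _ s)) eq)
... | inj₁ r≡0 = r≡0
... | inj₂ a≡0 = ⊥-elim (ℕP.<⇒≢ 0<a (sym (ℤP.+-injective a≡0)))

*-pos⇒nonneg : ∀ p {a b} → 0 ℕ.< a → p * + a ≡ + b → Σ ℕ λ n → p ≡ + n
*-pos⇒nonneg (+ n)     _         _  = n , refl
*-pos⇒nonneg -[1+ n ] (s≤s z≤n) ()

nonneg-units : ∀ p s {a a′ d d′} → 0 ℕ.< a → 0 ℕ.< d →
               p * + a ≡ + a′ → s * + d ≡ + d′ → p * s ≡ + 1 → p ≡ + 1 × s ≡ + 1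
nonneg-units p s 0<a 0<d pa≡ sd≡ ps≡1
  with p′ , refl ← *-pos⇒nonneg p 0<a pa≡ | s′ , refl ← *-pos⇒nonneg s 0<d sd≡ =
  cong +_ (ℕP.m*n≡1⇒m≡1 p′ s′ p′s′≡1) , cong +_ (ℕP.m*n≡1⇒n≡1 p′ s′ p′s′≡1)
  where
  p′s′≡1 : p′ ℕ.* s′ ≡ 1
  p′s′≡1 = ℤP.+-injective (trans (ℤP.pos-* p′ s′) ps≡1)

residue-clash : ∀ {u v d} k → v ℕ.< d → + u + + suc k * + d ≡ + v → ⊥
residue-clash {u} {v} {d} k v<d eq = ℕP.<⇒≱ v<d (begin
  d                   ≤⟨ ℕP.m≤m+n d (k ℕ.* d) ⟩
  suc k ℕ.* d         ≤⟨ ℕP.m≤n+m _ u ⟩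
  u ℕ.+ suc k ℕ.* d   ≡⟨ ℤP.+-injective (trans (ℤP.pos-+ u _) (trans (cong (λ t → + u + t) (ℤP.pos-* (suc k) d)) eq)) ⟩
  v                   ∎)
  where open ℕP.≤-Reasoning

residue-unique : ∀ q {u v d} → u ℕ.< d → v ℕ.< d → + u + q * + d ≡ + v → q ≡ + 0
residue-unique (+ 0)     _   _   _  = refl
residue-unique +[1+ k ] _   v<d eq = ⊥-elim (residue-clash k v<d eq)
residue-unique -[1+ k ] {u} {v} {d} u<d _ eq = ⊥-elim (residue-clash k u<d (begin
  + v + + suc k * + d                       ≡⟨ cong (_+ + suc k * + d) eq ⟨
  + u + -[1+ k ] * + d + + suc k * + d      ≡⟨ solve 3 (λ u t w → (u :+ (:- t) :* w) :+ t :* w := u) refl (+ u) (+ suc k) (+ d) ⟩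
  + u                                       ∎))
  where open ≡-Reasoning

-- Entrywise: the lower-left entry forces r = 0, positivity of the diagonal p = s = 1, and
-- 0 ≤ b, b′ < d forces q = 0.
Δ-rigid : ∀ {M} h (x y : Δ M) → det h ≡ + 1 → h · toMat x ≡ toMat y → h ≡ I₂ × x ≡ y
Δ-rigid (mat p q r s) x y det≡1 eq
  with refl ← lower-left-zero r s (0<a x) (cong c eq)
  with refl , refl ← nonneg-units p s (0<a x) (0<d x) (trans (sym (+-*-zeroʳ _ q)) (cong a eq))
                       (trans (sym (*-zeroˡ-+ (+ b' x) _)) (cong d eq)) (trans (sym (-‿*-zeroʳ _ q)) det≡1)
  with d≡ ← ℤP.+-injective (trans (sym (ℤP.*-identityˡ (+ d' x))) (trans (sym (*-zeroˡ-+ (+ b' x) _)) (cong d eq)))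
  with refl ← residue-unique q (b<d x) (subst (b' y ℕ.<_) (sym d≡) (b<d y))
                (trans (sym (*-identityˡ-+ (+ b' x) (q * + d' x))) (cong b eq))
  = refl , toMat-injective (trans (sym (·-identityˡ (toMat x))) eq)

decomposition-unique : ∀ {M} (J J′ : SL2Z) {x y : Δ M} →
                       ⟦ J ⟧ · toMat x ≡ ⟦ J′ ⟧ · toMat y → J ≈S J′ × x ≡ y
decomposition-unique J J′ {x} {y} eq =
  trans (inverseʳ-unique (J′ ⁻¹) J (proj₁ rigid)) (⁻¹-involutive J′) , proj₂ rigid
  where
  open ≡-Reasoning
  J′⁻¹J·x≡y : ⟦ J′ ⁻¹ ∙ J ⟧ · toMat x ≡ toMat y
  J′⁻¹J·x≡y = begin
    ⟦ J′ ⁻¹ ∙ J ⟧ · toMat x             ≡⟨ cong (_· toMat x) (trans (⟦∙⟧ (J′ ⁻¹) J) (cong (_· ⟦ J ⟧) (⟦⁻¹⟧ J′))) ⟩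
    (adj ⟦ J′ ⟧ · ⟦ J ⟧) · toMat x      ≡⟨ ·-assoc (adj ⟦ J′ ⟧) ⟦ J ⟧ (toMat x) ⟩
    adj ⟦ J′ ⟧ · (⟦ J ⟧ · toMat x)      ≡⟨ cong (adj ⟦ J′ ⟧ ·_) eq ⟩
    adj ⟦ J′ ⟧ · (⟦ J′ ⟧ · toMat y)     ≡⟨ sym (·-assoc (adj ⟦ J′ ⟧) ⟦ J′ ⟧ (toMat y)) ⟩
    (adj ⟦ J′ ⟧ · ⟦ J′ ⟧) · toMat y     ≡⟨ cong (_· toMat y) (adj-inverseˡ ⟦ J′ ⟧ (SL2Z.det≡1 J′)) ⟩
    I₂ · toMat y                        ≡⟨ ·-identityˡ (toMat y) ⟩
    toMat y                             ∎
  rigid : ⟦ J′ ⁻¹ ∙ J ⟧ ≡ I₂ × x ≡ y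
  rigid = Δ-rigid ⟦ J′ ⁻¹ ∙ J ⟧ x y (SL2Z.det≡1 (J′ ⁻¹ ∙ J)) J′⁻¹J·x≡y

⟦x∙y⁻¹⟧ : ∀ x y → ⟦ x ∙ y ⁻¹ ⟧ ≡ ⟦ x ⟧ · adj ⟦ y ⟧
⟦x∙y⁻¹⟧ x y = trans (⟦∙⟧ x (y ⁻¹)) (cong (⟦ x ⟧ ·_) (⟦⁻¹⟧ y))

module _ {M} (D : Decomposition M) where
  open Decomposition D
  open ≡-Reasoning

  I-bar-unique : ∀ {m γ n} J → toMat m · ⟦ γ ⟧ ≡ ⟦ J ⟧ · toMat n → I m γ ≈S J × bar m γ ≡ n
  I-bar-unique {m} {γ} J eq = decomposition-unique (I m γ) J (trans (sym (spec m γ)) eq)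

  I-bar-identity : ∀ m → I m 1S ≈S 1S × bar m 1S ≡ m
  I-bar-identity m = I-bar-unique 1S (trans (·-identityʳ (toMat m)) (sym (·-identityˡ (toMat m))))

  I-bar-∙ : ∀ m β γ → I m (β ∙ γ) ≈S I m β ∙ I (bar m β) γ × bar m (β ∙ γ) ≡ bar (bar m β) γ
  I-bar-∙ m β γ = I-bar-unique (I m β ∙ I m′ γ) (begin
    toMat m · ⟦ β ∙ γ ⟧                             ≡⟨ cong (toMat m ·_) (⟦∙⟧ β γ) ⟩
    toMat m · (⟦ β ⟧ · ⟦ γ ⟧)                       ≡⟨ sym (·-assoc (toMat m) ⟦ β ⟧ ⟦ γ ⟧) ⟩
    (toMat m · ⟦ β ⟧) · ⟦ γ ⟧                       ≡⟨ cong (_· ⟦ γ ⟧) (spec m β) ⟩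
    (⟦ I m β ⟧ · toMat m′) · ⟦ γ ⟧                  ≡⟨ ·-assoc ⟦ I m β ⟧ (toMat m′) ⟦ γ ⟧ ⟩
    ⟦ I m β ⟧ · (toMat m′ · ⟦ γ ⟧)                  ≡⟨ cong (⟦ I m β ⟧ ·_) (spec m′ γ) ⟩
    ⟦ I m β ⟧ · (⟦ I m′ γ ⟧ · toMat (bar m′ γ))     ≡⟨ sym (·-assoc ⟦ I m β ⟧ ⟦ I m′ γ ⟧ _) ⟩
    (⟦ I m β ⟧ · ⟦ I m′ γ ⟧) · toMat (bar m′ γ)     ≡⟨ cong (_· toMat (bar m′ γ)) (sym (⟦∙⟧ (I m β) (I m′ γ))) ⟩
    ⟦ I m β ∙ I m′ γ ⟧ · toMat (bar m′ γ)           ∎)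
    where
    m′ : Δ M
    m′ = bar m β

  same-bar⇒intertwines : ∀ m β β′ → bar m β ≡ bar m β′ →
    toMat m · ⟦ β ∙ β′ ⁻¹ ⟧ ≡ ⟦ I m β ∙ I m β′ ⁻¹ ⟧ · toMat m
  same-bar⇒intertwines m β β′ bar≡ = begin
    toMat m · ⟦ β ∙ β′ ⁻¹ ⟧                         ≡⟨ cong (toMat m ·_) (⟦x∙y⁻¹⟧ β β′) ⟩
    toMat m · (⟦ β ⟧ · adj ⟦ β′ ⟧)                  ≡⟨ sym (·-assoc (toMat m) ⟦ β ⟧ _) ⟩
    (toMat m · ⟦ β ⟧) · adj ⟦ β′ ⟧                  ≡⟨ cong (_· adj ⟦ β′ ⟧) (spec m β) ⟩
    (⟦ I m β ⟧ · toMat (bar m β)) · adj ⟦ β′ ⟧      ≡⟨ ·-assoc ⟦ I m β ⟧ _ _ ⟩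
    ⟦ I m β ⟧ · (toMat (bar m β) · adj ⟦ β′ ⟧)      ≡⟨ cong (λ n → ⟦ I m β ⟧ · (toMat n · adj ⟦ β′ ⟧)) bar≡ ⟩
    ⟦ I m β ⟧ · (toMat (bar m β′) · adj ⟦ β′ ⟧)     ≡⟨ cong (⟦ I m β ⟧ ·_) (sym (intertwine-inverse _ _ β′ (I m β′) (spec m β′))) ⟩
    ⟦ I m β ⟧ · (adj ⟦ I m β′ ⟧ · toMat m)          ≡⟨ sym (·-assoc ⟦ I m β ⟧ _ _) ⟩
    (⟦ I m β ⟧ · adj ⟦ I m β′ ⟧) · toMat m          ≡⟨ cong (_· toMat m) (sym (⟦x∙y⁻¹⟧ (I m β) (I m β′))) ⟩
    ⟦ I m β ∙ I m β′ ⁻¹ ⟧ · toMat m                 ∎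

ΔConj : ∀ {p} → (SL2Z → Set p) → ℕ → SL2Z → Set p
ΔConj H M γ = ∀ (m : Δ M) → Σ SL2Z λ J → H J × (toMat m · ⟦ γ ⟧ ≡ ⟦ J ⟧ · toMat m)

ΔConj-resp : ∀ {p} {H : SL2Z → Set p} {M γ η} → γ ≈S η → ΔConj H M γ → ΔConj H M η
ΔConj-resp γ≈η γ∈ m = let J , J∈H , eq = γ∈ m in J , J∈H , trans (cong (toMat m ·_) (sym γ≈η)) eq

ΔConj-⁻¹ : ∀ {p} {H : SL2Z → Set p} → IsNormalSubgroup SL₂ℤ H → ∀ {M γ} → ΔConj H M γ → ΔConj H M (γ ⁻¹)
ΔConj-⁻¹ H-normal {γ = γ} γ∈ m = let J , J∈H , eq = γ∈ m in
  J ⁻¹ , IsNormalSubgroup.⁻¹-closed H-normal J∈H ,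
  trans (cong (toMat m ·_) (⟦⁻¹⟧ γ))
        (trans (sym (intertwine-inverse (toMat m) (toMat m) γ J eq)) (cong (_· toMat m) (sym (⟦⁻¹⟧ J))))

module _ {c ℓ m ℓm} {R : CommutativeRing c ℓ} {V : LeftModule (CommutativeRing.ring R) m ℓm}
         (ρ : Rep R V) where
  open LeftModule V
  open Rep ρ

  act-∙ : ∀ γ η v → act (γ ∙ η) v ≈ᴹ act γ (act η v)
  act-∙ γ η v = ≈ᴹ-trans (act-≈S v (⟦∙⟧ γ η)) (act-∘ γ η v)

  act-inverseˡ : ∀ g v → act (g ⁻¹) (act g v) ≈ᴹ v
  act-inverseˡ g v = ≈ᴹ-trans (≈ᴹ-sym (act-∙ (g ⁻¹) g v))
    (≈ᴹ-trans (act-≈S v (trans (⟦∙⟧ (g ⁻¹) g) (trans (cong (_· ⟦ g ⟧) (⟦⁻¹⟧ g)) (adj-inverseˡ ⟦ g ⟧ (SL2Z.det≡1 g)))))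
              (act-1 v))

  ker-isNormalSubgroup : IsNormalSubgroup SL₂ℤ (ker R ρ)
  ker-isNormalSubgroup = record
    { resp-≈      = λ γ≈η γ∈ v → ≈ᴹ-trans (act-≈S v (sym γ≈η)) (γ∈ v)
    ; ∙-closed    = λ {γ} {η} γ∈ η∈ v → ≈ᴹ-trans (act-∙ γ η v) (≈ᴹ-trans (act-cong γ (η∈ v)) (γ∈ v))
    ; ⁻¹-closed   = λ {γ} γ∈ v → ≈ᴹ-trans (act-cong (γ ⁻¹) (≈ᴹ-sym (γ∈ v))) (act-inverseˡ γ v)
    ; conj-closed = λ g {h} h∈ v → ≈ᴹ-trans (act-∙ (g ⁻¹) (h ∙ g) v)
        (≈ᴹ-trans (act-cong (g ⁻¹) (≈ᴹ-trans (act-∙ h g v) (h∈ (act g v)))) (act-inverseˡ g v))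
    }

  ⊗e-cong : ∀ {M} {u v} {m m′ : Δ M} n → u ≈ᴹ v → m ≡ m′ → _⊗e_ R ρ u m n ≈ᴹ _⊗e_ R ρ v m′ n
  ⊗e-cong {m = m} n u≈v refl with n ≟Δ m
  ... | yes _ = u≈v
  ... | no _  = ≈ᴹ-refl

  ΔConj⇒kerT : ∀ {M} (D : Decomposition M) {γ} → ΔConj (ker R ρ) M γ → kerT R ρ D γ
  ΔConj⇒kerT {M} D {γ} γ∈ v m n = conclude (ΔConj-⁻¹ ker-isNormalSubgroup {M} {γ} γ∈ m)
    where
    open Decomposition D
    open IsNormalSubgroup ker-isNormalSubgroup using (⁻¹-closed)
    conclude : Σ SL2Z (λ J → ker R ρ J × (toMat m · ⟦ γ ⁻¹ ⟧ ≡ ⟦ J ⟧ · toMat m)) →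
               T-basis R ρ D γ v m n ≈ᴹ _⊗e_ R ρ v m n
    conclude (J , J∈ker , eq) =
      let I≈J , bar≡m = I-bar-unique D {m} {invS γ} {m} J (trans (cong (toMat m ·_) (sym (⟦⁻¹⟧ γ))) eq) in
      ⊗e-cong n (≈ᴹ-trans (act-≈S v (trans (cong adj I≈J) (sym (⟦⁻¹⟧ J)))) (⁻¹-closed J∈ker v)) bar≡m

I₂+[_]_ : ℤ → Mat → Mat
I₂+[ k ] x = mat (+ 1 + k * a x) (k * b x) (k * c x) (+ 1 + k * d x)

-- Both sides equal x + k (det x) x X, because adj x · x = (det x) I₂.
conj-I₂+ : ∀ k x X → x · I₂+[ k * det x ] X ≡ I₂+[ k ] ((x · X) · adj x) · x
conj-I₂+ k (mat a b c d) (mat p q r s) = mat-cong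
  (solve 9 (λ k a b c d p q r s →
     a :* (con (+ 1) :+ k :* (a :* d :- b :* c) :* p) :+ b :* (k :* (a :* d :- b :* c) :* r)
     := (con (+ 1) :+ k :* ((a :* p :+ b :* r) :* d :+ (a :* q :+ b :* s) :* (:- c))) :* a
        :+ k :* ((a :* p :+ b :* r) :* (:- b) :+ (a :* q :+ b :* s) :* a) :* c) refl k a b c d p q r s)
  (solve 9 (λ k a b c d p q r s →
     a :* (k :* (a :* d :- b :* c) :* q) :+ b :* (con (+ 1) :+ k :* (a :* d :- b :* c) :* s)
     := (con (+ 1) :+ k :* ((a :* p :+ b :* r) :* d :+ (a :* q :+ b :* s) :* (:- c))) :* b
        :+ k :* ((a :* p :+ b :* r) :* (:- b) :+ (a :* q :+ b :* s) :* a) :* d) refl k a b c d p q r s)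
  (solve 9 (λ k a b c d p q r s →
     c :* (con (+ 1) :+ k :* (a :* d :- b :* c) :* p) :+ d :* (k :* (a :* d :- b :* c) :* r)
     := k :* ((c :* p :+ d :* r) :* d :+ (c :* q :+ d :* s) :* (:- c)) :* a
        :+ (con (+ 1) :+ k :* ((c :* p :+ d :* r) :* (:- b) :+ (c :* q :+ d :* s) :* a)) :* c) refl k a b c d p q r s)
  (solve 9 (λ k a b c d p q r s →
     c :* (k :* (a :* d :- b :* c) :* q) :+ d :* (con (+ 1) :+ k :* (a :* d :- b :* c) :* s)
     := k :* ((c :* p :+ d :* r) :* d :+ (c :* q :+ d :* s) :* (:- c)) :* b
        :+ (con (+ 1) :+ k :* ((c :* p :+ d :* r) :* (:- b) :+ (c :* q :+ d :* s) :* a)) :* d) refl k a b c d p q r s)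

InΓ⇒≡I₂+ : ∀ {N} γ → InΓ N γ → Σ Mat λ X → ⟦ γ ⟧ ≡ I₂+[ + N ] X
InΓ⇒≡I₂+ {N} γ (N∣a-1 , N∣b , N∣c , N∣d-1)
  with divides p a-1≡ ← ∣ᵤ⇒∣ N∣a-1 | divides q b≡ ← ∣ᵤ⇒∣ N∣b
     | divides r c≡ ← ∣ᵤ⇒∣ N∣c     | divides s d-1≡ ← ∣ᵤ⇒∣ N∣d-1 =
  mat p q r s , mat-cong (unshift a-1≡) (trans b≡ (ℤP.*-comm q (+ N)))
                         (trans c≡ (ℤP.*-comm r (+ N))) (unshift d-1≡)
  where
  unshift : ∀ {x t} → x - + 1 ≡ t * + N → x ≡ + 1 + + N * t
  unshift {x} {t} eq = trans (solve 1 (λ x → x := con (+ 1) :+ (x :- con (+ 1))) refl x)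
                             (cong (λ u → + 1 + u) (trans eq (ℤP.*-comm t (+ N))))

≡I₂+⇒InΓ : ∀ {N} γ X → ⟦ γ ⟧ ≡ I₂+[ + N ] X → InΓ N γ
≡I₂+⇒InΓ {N} γ X refl =
  ∣⇒∣ᵤ (divides (a X) (shift (a X))) , ∣⇒∣ᵤ (divides (b X) (ℤP.*-comm (+ N) (b X))) ,
  ∣⇒∣ᵤ (divides (c X) (ℤP.*-comm (+ N) (c X))) , ∣⇒∣ᵤ (divides (d X) (shift (d X)))
  where
  shift : ∀ t → + 1 + + N * t - + 1 ≡ t * + N
  shift t = solve 2 (λ n t → con (+ 1) :+ n :* t :- con (+ 1) := t :* n) refl (+ N) t

det-toMat : ∀ {M} (m : Δ M) → det (toMat m) ≡ + M
det-toMat m = begin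
  + a' m * + d' m - + b' m * + 0  ≡⟨ solve 3 (λ x y z → x :* y :- z :* con (+ 0) := x :* y) refl (+ a' m) (+ d' m) (+ b' m) ⟩
  + a' m * + d' m                 ≡⟨ sym (ℤP.pos-* (a' m) (d' m)) ⟩
  + (a' m ℕ.* d' m)               ≡⟨ cong +_ (ad≡M m) ⟩
  + _                             ∎
  where open ≡-Reasoning

Γ⊆ΔConj : ∀ {p} {H : SL2Z → Set p} {N M} → 0 ℕ.< M →
          (∀ γ → InΓ N γ → H γ) → ∀ γ → InΓ (N ℕ.* M) γ → ΔConj H M γ
Γ⊆ΔConj {N = N} {M} 0<M Γ⊆H γ γ∈Γ m = J , Γ⊆H J (≡I₂+⇒InΓ J _ refl) , m·γ≡J·m
  where
  open ≡-Reasoning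
  X : Mat
  X = proj₁ (InΓ⇒≡I₂+ γ γ∈Γ)
  x : Mat
  x = toMat m
  Jₘ : Mat
  Jₘ = I₂+[ + N ] ((x · X) · adj x)
  m·γ≡J·m : x · ⟦ γ ⟧ ≡ Jₘ · x
  m·γ≡J·m = begin
    x · ⟦ γ ⟧                       ≡⟨ cong (x ·_) (proj₂ (InΓ⇒≡I₂+ γ γ∈Γ)) ⟩
    x · I₂+[ + (N ℕ.* M) ] X        ≡⟨ cong (λ k → x · I₂+[ k ] X) (trans (ℤP.pos-* N M) (cong (+ N *_) (sym (det-toMat m)))) ⟩
    x · I₂+[ + N * det x ] X        ≡⟨ conj-I₂+ (+ N) x X ⟩
    Jₘ · x                          ∎
  det-Jₘ : det Jₘ ≡ + 1
  det-Jₘ = ℤP.*-cancelʳ-≡ (det Jₘ) (+ 1) (+ M) {{ℕ.>-nonZero 0<M}} (begin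
    det Jₘ * + M                    ≡⟨ cong (det Jₘ *_) (sym (det-toMat m)) ⟩
    det Jₘ * det x                  ≡⟨ sym (det-· Jₘ x) ⟩
    det (Jₘ · x)                    ≡⟨ cong det (sym m·γ≡J·m) ⟩
    det (x · ⟦ γ ⟧)                 ≡⟨ det-· x ⟦ γ ⟧ ⟩
    det x * det ⟦ γ ⟧               ≡⟨ cong₂ _*_ (det-toMat m) (SL2Z.det≡1 γ) ⟩
    + M * + 1                       ≡⟨ ℤP.*-comm (+ M) (+ 1) ⟩
    + 1 * + M                       ∎)
  J : SL2Z
  J = sl Jₘ det-Jₘ

-- Generation of SL₂(ℤ) by S and T

data Gen : Set where
  S T T⁻¹ : Gen

gen : Gen → SL2Z
gen S   = sl (mat (+ 0) (- + 1) (+ 1) (+ 0)) refl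
gen T   = sl (mat (+ 1) (+ 1) (+ 0) (+ 1)) refl
gen T⁻¹ = sl (mat (+ 1) (- + 1) (+ 0) (+ 1)) refl

⟪_⟫ : List Gen → Mat
⟪ [] ⟫    = I₂
⟪ s ∷ w ⟫ = ⟦ gen s ⟧ · ⟪ w ⟫

⟪⟫-++ : ∀ w w′ → ⟪ w ++ w′ ⟫ ≡ ⟪ w ⟫ · ⟪ w′ ⟫
⟪⟫-++ []      w′ = sym (·-identityˡ ⟪ w′ ⟫)
⟪⟫-++ (s ∷ w) w′ = trans (cong (⟦ gen s ⟧ ·_) (⟪⟫-++ w w′)) (sym (·-assoc ⟦ gen s ⟧ ⟪ w ⟫ ⟪ w′ ⟫))

infixl 30 _∙ʷ_
_∙ʷ_ : SL2Z → List Gen → SL2Z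
β ∙ʷ []      = β
β ∙ʷ (s ∷ w) = (β ∙ gen s) ∙ʷ w

⟦∙ʷ⟧ : ∀ β w → ⟦ β ∙ʷ w ⟧ ≡ ⟦ β ⟧ · ⟪ w ⟫
⟦∙ʷ⟧ β []      = sym (·-identityʳ ⟦ β ⟧)
⟦∙ʷ⟧ β (s ∷ w) = trans (⟦∙ʷ⟧ (β ∙ gen s) w) (trans (cong (_· ⟪ w ⟫) (⟦∙⟧ β (gen s))) (·-assoc ⟦ β ⟧ ⟦ gen s ⟧ ⟪ w ⟫))

upper : ℤ → Mat
upper k = mat (+ 1) k (+ 0) (+ 1)

T^_ : ℤ → List Gen
T^ (+ n)    = replicate n T
T^ -[1+ n ] = replicate (suc n) T⁻¹

⟪T^⟫ : ∀ k → ⟪ T^ k ⟫ ≡ upper k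
⟪T^⟫ (+ n)    = Tⁿ n
  where
  Tⁿ : ∀ n → ⟪ replicate n T ⟫ ≡ upper (+ n)
  Tⁿ zero    = refl
  Tⁿ (suc n) = trans (cong (⟦ gen T ⟧ ·_) (Tⁿ n)) (mat-cong refl
    (trans (solve 1 (λ k → con (+ 1) :* k :+ con (+ 1) :* con (+ 1) := con (+ 1) :+ k) refl (+ n))
           (sym (ℤP.pos-+ 1 n))) refl refl)
⟪T^⟫ -[1+ n ] = T⁻ⁿ (suc n)
  where
  T⁻ⁿ : ∀ n → ⟪ replicate n T⁻¹ ⟫ ≡ upper (- + n)
  T⁻ⁿ zero    = refl
  T⁻ⁿ (suc n) = trans (cong (⟦ gen T⁻¹ ⟧ ·_) (T⁻ⁿ n)) (mat-cong refl
    (trans (solve 1 (λ k → con (+ 1) :* (:- k) :+ (:- con (+ 1)) :* con (+ 1) := :- (con (+ 1) :+ k)) refl (+ n))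
           (cong -_ (sym (ℤP.pos-+ 1 n)))) refl refl)

S· : ∀ x → ⟦ gen S ⟧ · x ≡ mat (- c x) (- d x) (a x) (b x)
S· (mat a b c d) = mat-cong (l a c) (l b d) (l′ a c) (l′ b d)
  where
  l : ∀ x y → + 0 * x + - (+ 1) * y ≡ - y
  l = solve 2 (λ x y → con (+ 0) :* x :+ :- (con (+ 1)) :* y := :- y) refl
  l′ : ∀ x y → + 1 * x + + 0 * y ≡ x
  l′ = solve 2 (λ x y → con (+ 1) :* x :+ con (+ 0) :* y := x) refl

private
  ∣unit∣≡1 : ∀ a d → a * d ≡ + 1 → ℤ.∣ a ∣ ≡ 1
  ∣unit∣≡1 a d ad≡1 = ℕP.m*n≡1⇒m≡1 ℤ.∣ a ∣ ℤ.∣ d ∣ (trans (sym (ℤP.abs-* a d)) (cong ℤ.∣_∣ ad≡1))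

upper-triangular-generated : ∀ a b d → a * d ≡ + 1 → Σ (List Gen) λ w → ⟪ w ⟫ ≡ mat a b (+ 0) d
upper-triangular-generated (+ 0)        b d ()
upper-triangular-generated +[1+ suc k ] b d ad≡1 with () ← ∣unit∣≡1 +[1+ suc k ] d ad≡1
upper-triangular-generated -[1+ suc k ] b d ad≡1 with () ← ∣unit∣≡1 -[1+ suc k ] d ad≡1
upper-triangular-generated +[1+ zero ]  b d ad≡1 =
  T^ b , trans (⟪T^⟫ b) (cong (mat (+ 1) b (+ 0)) (trans (sym ad≡1) (ℤP.*-identityˡ d)))
upper-triangular-generated -[1+ zero ]  b d ad≡1 = S ∷ S ∷ T^ (- b) , (begin
  ⟦ gen S ⟧ · (⟦ gen S ⟧ · ⟪ T^ (- b) ⟫) ≡⟨ cong (λ x → ⟦ gen S ⟧ · (⟦ gen S ⟧ · x)) (⟪T^⟫ (- b)) ⟩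
  ⟦ gen S ⟧ · (⟦ gen S ⟧ · upper (- b))  ≡⟨ trans (cong (⟦ gen S ⟧ ·_) (S· (upper (- b)))) (S· _) ⟩
  mat (- + 1) (- - b) (+ 0) (- + 1)      ≡⟨ mat-cong refl (ℤP.neg-involutive b) refl d≡-1 ⟩
  mat (- + 1) b (+ 0) d                  ∎)
  where
  open ≡-Reasoning
  d≡-1 : - + 1 ≡ d
  d≡-1 = trans (cong -_ (trans (sym ad≡1) (ℤP.-1*i≡-i d))) (ℤP.neg-involutive d)

S³·upper : ∀ k → ⟪ S ∷ S ∷ S ∷ T^ (- k) ⟫ ≡ mat (+ 0) (+ 1) (- + 1) (- - k)
S³·upper k = begin
  ⟦ gen S ⟧ · (⟦ gen S ⟧ · (⟦ gen S ⟧ · ⟪ T^ (- k) ⟫))  ≡⟨ cong (λ x → ⟦ gen S ⟧ · (⟦ gen S ⟧ · (⟦ gen S ⟧ · x))) (⟪T^⟫ (- k)) ⟩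
  ⟦ gen S ⟧ · (⟦ gen S ⟧ · (⟦ gen S ⟧ · upper (- k)))   ≡⟨ cong (λ x → ⟦ gen S ⟧ · (⟦ gen S ⟧ · x)) (S· (upper (- k))) ⟩
  ⟦ gen S ⟧ · (⟦ gen S ⟧ · mat (- + 0) (- + 1) (+ 1) (- k)) ≡⟨ cong (⟦ gen S ⟧ ·_) (S· (mat (- + 0) (- + 1) (+ 1) (- k))) ⟩
  ⟦ gen S ⟧ · mat (- + 1) (- - k) (- - + 0) (- + 1)      ≡⟨ S· (mat (- + 1) (- - k) (- - + 0) (- + 1)) ⟩
  mat (+ 0) (+ 1) (- + 1) (- - k)                        ∎
  where open ≡-Reasoning

-- The left factor is x T^k S: right multiplication by T^k S turns the bottom row (c, d) into
-- (c k + d, - c), and S³ T^(-k) = (T^k S)⁻¹.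
euclid-step : ∀ a b c d k →
  mat (a * k + b) (- a) (c * k + d) (- c) · ⟪ S ∷ S ∷ S ∷ T^ (- k) ⟫ ≡ mat a b c d
euclid-step a b c d k = trans (cong (mat (a * k + b) (- a) (c * k + d) (- c) ·_) (S³·upper k))
  (mat-cong (l₁ a b k) (l₂ a b k) (l₁ c d k) (l₂ c d k))
  where
  l₁ : ∀ a b k → (a * k + b) * + 0 + (- a) * (- + 1) ≡ a
  l₁ = solve 3 (λ a b k → (a :* k :+ b) :* con (+ 0) :+ (:- a) :* (:- con (+ 1)) := a) refl
  l₂ : ∀ a b k → (a * k + b) * + 1 + (- a) * (- - k) ≡ b
  l₂ = solve 3 (λ a b k → (a :* k :+ b) :* con (+ 1) :+ (:- a) :* (:- (:- k)) := b) refl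

euclid-reduce : ∀ n a b c d .{{_ : ℤ.NonZero c}} →
  (∀ x → det x ≡ + 1 → ℤ.∣ Mat.c x ∣ ℕ.< n → Σ (List Gen) λ w → ⟪ w ⟫ ≡ x) →
  det (mat a b c d) ≡ + 1 → ℤ.∣ c ∣ ℕ.< suc n → Σ (List Gen) λ w → ⟪ w ⟫ ≡ mat a b c d
euclid-reduce n a b c d generated det≡1 ∣c∣<1+n =
  proj₁ z-generated ++ (S ∷ S ∷ S ∷ T^ (- k)) ,
  trans (⟪⟫-++ (proj₁ z-generated) _) (trans (cong (_· ⟪ S ∷ S ∷ S ∷ T^ (- k) ⟫) (proj₂ z-generated))
                                              (euclid-step a b c d k))
  where
  k : ℤ
  k = - (d / c)
  z : Mat
  z = mat (a * k + b) (- a) (c * k + d) (- c)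
  ck+d≡d%c : c * k + d ≡ + (d % c)
  ck+d≡d%c = trans (cong (λ u → c * k + u) (a≡a%n+[a/n]*n d c))
    (solve 3 (λ c q r → c :* (:- q) :+ (r :+ q :* c) := r) refl c (d / c) (+ (d % c)))
  det-z : det z ≡ + 1
  det-z = trans (solve 5 (λ a b c d k → (a :* k :+ b) :* (:- c) :- (:- a) :* (c :* k :+ d) := a :* d :- b :* c)
                  refl a b c d k) det≡1
  z-generated : Σ (List Gen) λ w → ⟪ w ⟫ ≡ z
  z-generated = generated z det-z (subst (ℕ._< n) (sym (cong ℤ.∣_∣ ck+d≡d%c))
                                         (ℕP.<-≤-trans (n%d<d d c) (ℕP.≤-pred ∣c∣<1+n)))

generated-below : ∀ n x → det x ≡ + 1 → ℤ.∣ c x ∣ ℕ.< n → Σ (List Gen) λ w → ⟪ w ⟫ ≡ x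
generated-below n (mat a b (+ 0) d) det≡1 _ =
  upper-triangular-generated a b d (trans (solve 3 (λ a b d → a :* d := a :* d :- b :* con (+ 0)) refl a b d) det≡1)
generated-below (suc n) (mat a b c@(+[1+ _ ]) d) = euclid-reduce n a b c d (generated-below n)
generated-below (suc n) (mat a b c@(-[1+ _ ]) d) = euclid-reduce n a b c d (generated-below n)

SL₂ℤ-generated : ∀ γ → Σ (List Gen) λ w → 1S ∙ʷ w ≈S γ
SL₂ℤ-generated γ = let w , ⟪w⟫≡γ = generated-below _ ⟦ γ ⟧ (SL2Z.det≡1 γ) (ℕP.n<1+n _) in
  w , trans (⟦∙ʷ⟧ 1S w) (trans (·-identityˡ ⟪ w ⟫) ⟪w⟫≡γ)

gens : List Gen
gens = S ∷ T ∷ T⁻¹ ∷ []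

∈-gens : ∀ s → s ∈ gens
∈-gens S   = here refl
∈-gens T   = there (here refl)
∈-gens T⁻¹ = there (there (here refl))

-- Finite state spaces and the pigeonhole principle

words : ∀ {A : Set} → List A → ℕ → List (List A)
words as zero    = [] ∷ []
words as (suc L) = [] ∷ cartesianProductWith _∷_ as (words as L)

∈-words : ∀ {A : Set} {as : List A} → (∀ x → x ∈ as) → ∀ {L} w → length w ℕ.≤ L → w ∈ words as L
∈-words all {zero}  []      _        = here refl
∈-words all {suc L} []      _        = here refl
∈-words all {suc L} (x ∷ w) (s≤s ≤L) = there (∈-cartesianProductWith⁺ _∷_ (all x) (∈-words all w ≤L))

×↣Fin : ∀ {m n} → (Fin m × Fin n) ↣ Fin (m ℕ.* n)
×↣Fin = mk↣ λ {(i , j)} {(k , l)} eq →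
  let i≡k , j≡l = FinP.combine-injective i j k l eq in cong₂ _,_ i≡k j≡l

Vec↣Fin : ∀ {A : Set} {n} k → A ↣ Fin n → Vec A k ↣ Fin (n ℕ.^ k)
Vec↣Fin {A} {n} k f = mk↣ (λ {xs} {ys} → encode-injective xs ys)
  where
  open Injection f using (to; injective)
  encode : ∀ {k} → Vec A k → Fin (n ℕ.^ k)
  encode []       = Fin.zero
  encode (x ∷ xs) = combine (to x) (encode xs)
  encode-injective : ∀ {k} (xs ys : Vec A k) → encode xs ≡ encode ys → xs ≡ ys
  encode-injective []       []       _  = refl
  encode-injective (x ∷ xs) (y ∷ ys) eq =
    let x≡y , xs≡ys = FinP.combine-injective (to x) (encode xs) (to y) (encode ys) eq
    in cong₂ _∷_ (injective x≡y) (encode-injective xs ys xs≡ys)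

module _ {A Q : Set} (step : Q → A → Q) {n} (code : Q ↣ Fin n) where
  open Injection code using (to; injective)

  cut-loop : ∀ q w {i j} → i ℕ.< j → j ℕ.≤ length w →
             foldl step q (take i w) ≡ foldl step q (take j w) →
             length (take i w ++ drop j w) ℕ.< length w × foldl step q (take i w ++ drop j w) ≡ foldl step q w
  cut-loop q w {i} {j} i<j j≤∣w∣ loop = shorter , same-state
    where
    shorter : length (take i w ++ drop j w) ℕ.< length w
    shorter = begin-strict
      length (take i w ++ drop j w)              ≡⟨ ListP.length-++ (take i w) ⟩
      length (take i w) ℕ.+ length (drop j w)    ≡⟨ cong₂ ℕ._+_ (trans (ListP.length-take i w)
                                                                     (ℕP.m≤n⇒m⊓n≡m (ℕP.≤-trans (ℕP.<⇒≤ i<j) j≤∣w∣)))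
                                                                (ListP.length-drop j w) ⟩
      i ℕ.+ (length w ∸ j)                       <⟨ ℕP.+-monoˡ-< (length w ∸ j) i<j ⟩
      j ℕ.+ (length w ∸ j)                       ≡⟨ ℕP.m+[n∸m]≡n j≤∣w∣ ⟩
      length w                                   ∎
      where open ℕP.≤-Reasoning
    same-state : foldl step q (take i w ++ drop j w) ≡ foldl step q w
    same-state = begin
      foldl step q (take i w ++ drop j w)              ≡⟨ ListP.foldl-++ step q (take i w) _ ⟩
      foldl step (foldl step q (take i w)) (drop j w)  ≡⟨ cong (λ q′ → foldl step q′ (drop j w)) loop ⟩
      foldl step (foldl step q (take j w)) (drop j w)  ≡⟨ ListP.foldl-++ step q (take j w) _ ⟨
      foldl step q (take j w ++ drop j w)              ≡⟨ cong (foldl step q) (ListP.take++drop≡id j w) ⟩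
      foldl step q w                                   ∎
      where open ≡-Reasoning

  shorten-once : ∀ q w → n ℕ.< length w →
                 Σ (List A) λ w′ → length w′ ℕ.< length w × foldl step q w′ ≡ foldl step q w
  shorten-once q w n<∣w∣
    with i , j , i<j , same-code ← FinP.pigeonhole (ℕP.n<1+n n) (λ k → to (foldl step q (take (toℕ k) w))) =
    take (toℕ i) w ++ drop (toℕ j) w ,
    cut-loop q w i<j (ℕP.≤-trans (ℕP.≤-pred (FinP.toℕ<n j)) (ℕP.<⇒≤ n<∣w∣)) (injective same-code)

  shorten : ∀ q w → Σ (List A) λ w′ → length w′ ℕ.≤ n × foldl step q w′ ≡ foldl step q w
  shorten q w = shorten-below (suc (length w)) w (ℕP.n<1+n _)
    where
    shorten-below : ∀ fuel w → length w ℕ.< fuel →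
                    Σ (List A) λ w′ → length w′ ℕ.≤ n × foldl step q w′ ≡ foldl step q w
    shorten-below (suc fuel) w ∣w∣<fuel with length w ℕP.≤? n
    ... | yes ∣w∣≤n = w , ∣w∣≤n , refl
    ... | no  ∣w∣≰n =
      let w′ , ∣w′∣<∣w∣ , w′∼w = shorten-once q w (ℕP.≰⇒> ∣w∣≰n)
          w″ , ∣w″∣≤n , w″∼w′ = shorten-below fuel w′ (ℕP.<-≤-trans ∣w′∣<∣w∣ (ℕP.≤-pred ∣w∣<fuel))
      in w″ , ∣w″∣≤n , trans w″∼w′ w′∼w

module _ {M} (0<M : 0 ℕ.< M) where
  private
    toΔ : ℕ × ℕ × ℕ → Δ M
    toΔ (a , b , d) with a ℕ.* d ℕ.≟ M | 0 ℕP.<? a | 0 ℕP.<? d | b ℕP.<? d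
    ... | yes ad≡M | yes 0<a | yes 0<d | yes b<d = δ a b d ad≡M 0<a 0<d b<d
    ... | _        | _       | _       | _       = δ M 0 1 (ℕP.*-identityʳ M) 0<M (s≤s z≤n) (s≤s z≤n)

    toΔ-entries : ∀ m → toΔ (a' m , b' m , d' m) ≡ m
    toΔ-entries m with a' m ℕ.* d' m ℕ.≟ M | 0 ℕP.<? a' m | 0 ℕP.<? d' m | b' m ℕP.<? d' m
    ... | yes _    | yes _    | yes _    | yes _    = toMat-injective refl
    ... | no ad≢M  | _        | _        | _        = contradiction (ad≡M m) ad≢M
    ... | yes _    | no ¬0<a  | _        | _        = contradiction (0<a m) ¬0<a
    ... | yes _    | yes _    | no ¬0<d  | _        = contradiction (0<d m) ¬0<d
    ... | yes _    | yes _    | yes _    | no b≮d   = contradiction (b<d m) b≮d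

    entries : List ℕ
    entries = upTo (suc M)

    d≤M : ∀ (m : Δ M) → d' m ℕ.≤ M
    d≤M m = subst (d' m ℕ.≤_) (ad≡M m) (ℕP.m≤n*m (d' m) (a' m) {{ℕ.>-nonZero (0<a m)}})

  Δs : List (Δ M)
  Δs = map toΔ (cartesianProduct entries (cartesianProduct entries entries))

  ∈-Δs : ∀ m → m ∈ Δs
  ∈-Δs m = subst (_∈ Δs) (toΔ-entries m) (∈-map⁺ toΔ (∈-cartesianProduct⁺ (∈-upTo⁺ a≤M)
             (∈-cartesianProduct⁺ (∈-upTo⁺ (ℕP.m<n⇒m<1+n (ℕP.<-≤-trans (b<d m) (d≤M m)))) (∈-upTo⁺ (s≤s (d≤M m))))))
    where
    a≤M : a' m ℕ.< suc M
    a≤M = s≤s (subst (a' m ℕ.≤_) (ad≡M m) (ℕP.m≤m*n (a' m) (d' m) {{ℕ.>-nonZero (0<d m)}}))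

-- The coset automaton

module _ {p} {H : SL2Z → Set p} (H-normal : IsNormalSubgroup SL₂ℤ H) (H-finite : FiniteIndex H)
         {M} (0<M : 0 ℕ.< M) (D : Decomposition M) where
  open IsNormalSubgroup H-normal
  open Decomposition D

  private
    nG : ℕ
    nG = length (proj₁ H-finite)

    rep : Fin nG → SL2Z
    rep = List.lookup (proj₁ H-finite)

    coset : SL2Z → Fin nG
    coset γ = Any.index (proj₁ (proj₂ (proj₂ H-finite γ)))

    ∈-rep-coset : ∀ γ → H (rep (coset γ) ⁻¹ ∙ γ)
    ∈-rep-coset γ = let g , g∈ , γ∈gH = proj₂ H-finite γ in
      resp-≈ (trans (cong (λ r → adj ⟦ r ⟧ · ⟦ γ ⟧) (lookup-index g∈))
                    (sym (trans (⟦∙⟧ _ γ) (cong (_· ⟦ γ ⟧) (⟦⁻¹⟧ _))))) γ∈gH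

    K : ℕ
    K = length (Δs 0<M)

    m⟨_⟩ : Fin K → Δ M
    m⟨_⟩ = List.lookup (Δs 0<M)

    index : Δ M → Fin K
    index m = Any.index (∈-Δs 0<M m)

    m⟨index⟩ : ∀ m → m⟨ index m ⟩ ≡ m
    m⟨index⟩ m = sym (lookup-index (∈-Δs 0<M m))

  Label : Set
  Label = Fin K × Fin nG

  record Describes (l : Label) (m : Δ M) (β : SL2Z) : Set p where
    constructor describe
    field
      bar≡ : bar m β ≡ m⟨ proj₁ l ⟩
      I∈   : H (rep (proj₂ l) ⁻¹ ∙ I m β)

  -- Labels are not functions of β (`coset` need not be constant on cosets), but by the cocycle relation
  -- I_m(β s) = I_m(β) I_{\overline{mβ}}(s) and normality of H they can be updated letter by letter.
  next : Label → Gen → Label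
  next (k , i) s = index (bar m⟨ k ⟩ (gen s)) , coset (rep i ∙ I m⟨ k ⟩ (gen s))

  describes-next : ∀ {l m β} s → Describes l m β → Describes (next l s) m (β ∙ gen s)
  describes-next {k , i} {m} {β} s (describe bar≡ β∈) = describe
    (trans (proj₂ (I-bar-∙ D m β (gen s))) (trans (cong (λ n → bar n (gen s)) bar≡) (sym (m⟨index⟩ _))))
    (resp-≈ (∙-congˡ (sym I≈)) (coset-∙ʳ (rep i) r′ (I m β) J β∈ (∈-rep-coset (rep i ∙ J))))
    where
    J : SL2Z
    J = I m⟨ k ⟩ (gen s)
    r′ : SL2Z
    r′ = rep (coset (rep i ∙ J))
    I≈ : I m (β ∙ gen s) ≈S I m β ∙ J
    I≈ = trans (proj₁ (I-bar-∙ D m β (gen s))) (cong (λ n → ⟦ I m β ∙ I n (gen s) ⟧) bar≡)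

  State : Set
  State = Vec Label K

  _describes_ : State → SL2Z → Set p
  σ describes β = ∀ j → Describes (Vec.lookup σ j) m⟨ j ⟩ β

  step : State → Gen → State
  step σ s = Vec.map (λ l → next l s) σ

  initial : State
  initial = Vec.tabulate (λ j → j , coset 1S)

  initial-describes-1 : initial describes 1S
  initial-describes-1 j = subst (λ l → Describes l m⟨ j ⟩ 1S) (sym (VecP.lookup∘tabulate (λ j → j , coset 1S) j))
    (describe (proj₂ (I-bar-identity D m⟨ j ⟩))
              (resp-≈ (∙-congˡ (sym (proj₁ (I-bar-identity D m⟨ j ⟩)))) (∈-rep-coset 1S)))

  run-describes : ∀ σ β w → σ describes β → foldl step σ w describes (β ∙ʷ w)
  run-describes σ β []      σ∼β = σ∼β
  run-describes σ β (s ∷ w) σ∼β = run-describes (step σ s) (β ∙ gen s) w λ j →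
    subst (λ l → Describes l m⟨ j ⟩ (β ∙ gen s)) (sym (VecP.lookup-map j (λ l → next l s) σ))
          (describes-next s (σ∼β j))

  same-state⇒ΔConj : ∀ {σ β β′} → σ describes β → σ describes β′ → ΔConj H M (β ∙ β′ ⁻¹)
  same-state⇒ΔConj {σ} {β} {β′} σ∼β σ∼β′ m
    with describe bar≡ β∈ ← σ∼β (index m) | describe bar≡′ β′∈ ← σ∼β′ (index m) =
    I mᵢ β ∙ I mᵢ β′ ⁻¹ ,
    same-coset (rep (proj₂ (Vec.lookup σ (index m)))) (I mᵢ β) (I mᵢ β′) β∈ β′∈ ,
    subst (λ n → toMat n · ⟦ β ∙ β′ ⁻¹ ⟧ ≡ ⟦ I mᵢ β ∙ I mᵢ β′ ⁻¹ ⟧ · toMat n) (m⟨index⟩ m)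
          (same-bar⇒intertwines D mᵢ β β′ (trans bar≡ (sym bar≡′)))
    where
    mᵢ : Δ M
    mᵢ = m⟨ index m ⟩

  same-state⇒ΔConj-words : ∀ w w′ → foldl step initial w′ ≡ foldl step initial w →
                           ΔConj H M (1S ∙ʷ w ∙ (1S ∙ʷ w′) ⁻¹)
  same-state⇒ΔConj-words w w′ same = same-state⇒ΔConj {foldl step initial w}
    (run-describes initial 1S w initial-describes-1)
    (subst (_describes (1S ∙ʷ w′)) same (run-describes initial 1S w′ initial-describes-1))

  ΔConj-finiteIndex : FiniteIndex (ΔConj H M)
  ΔConj-finiteIndex = map (λ w → (1S ∙ʷ w) ⁻¹) (words gens N) , coset-rep
    where
    N : ℕ
    N = (K ℕ.* nG) ℕ.^ K
    inverse-quotient : ∀ {β γ} β′ → β ≈S γ ⁻¹ → (β ∙ β′ ⁻¹) ⁻¹ ≈S (invS (β′ ⁻¹) ∘S γ)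
    inverse-quotient {β} {γ} β′ β≈γ⁻¹ =
      trans (⁻¹-anti-homo-∙ β (β′ ⁻¹))
            (trans (∙-congˡ (trans (⁻¹-cong β≈γ⁻¹) (⁻¹-involutive γ)))
                   (trans (⟦∙⟧ (β′ ⁻¹ ⁻¹) γ) (cong (_· ⟦ γ ⟧) (⟦⁻¹⟧ (β′ ⁻¹)))))
    coset-rep : ∀ γ → Σ SL2Z λ g → g ∈ map (λ w → (1S ∙ʷ w) ⁻¹) (words gens N) × ΔConj H M (invS g ∘S γ)
    coset-rep γ =
      let w , w≈γ⁻¹ = SL₂ℤ-generated (γ ⁻¹)
          w′ , ∣w′∣≤N , same = shorten step (Vec↣Fin K ×↣Fin) initial w
      in (1S ∙ʷ w′) ⁻¹ , ∈-map⁺ (λ w → (1S ∙ʷ w) ⁻¹) (∈-words ∈-gens w′ ∣w′∣≤N) ,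
         ΔConj-resp {H = H} {M} {(1S ∙ʷ w ∙ (1S ∙ʷ w′) ⁻¹) ⁻¹} {invS ((1S ∙ʷ w′) ⁻¹) ∘S γ}
           (inverse-quotient (1S ∙ʷ w′) w≈γ⁻¹) (ΔConj-⁻¹ H-normal (same-state⇒ΔConj-words w w′ same))

lemma2p3 : ∀ {c ℓ m ℓm} (R : CommutativeRing c ℓ)
             (V : LeftModule (CommutativeRing.ring R) m ℓm)
             (ρ : Rep R V) → FinDim R V →
             (M : ℕ) → 0 < M → (D : Decomposition M) →
             (FiniteIndex (ker R ρ) → FiniteIndex (kerT R ρ D))
             × (IsCongruence (ker R ρ) → IsCongruence (kerT R ρ D))
lemma2p3 R V ρ _ M 0<M D = finite-index , congruence
  where
  kerT⊇ΔConj : ∀ {γ} → ΔConj (ker R ρ) M γ → kerT R ρ D γ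
  kerT⊇ΔConj {γ} = ΔConj⇒kerT ρ D {γ}

  finite-index : FiniteIndex (ker R ρ) → FiniteIndex (kerT R ρ D)
  finite-index ker-finite = proj₁ ΔConj-finite , λ γ →
    let g , g∈gs , g⁻¹γ∈ΔConj = proj₂ ΔConj-finite γ in g , g∈gs , kerT⊇ΔConj {invS g ∘S γ} g⁻¹γ∈ΔConj
    where
    ΔConj-finite : FiniteIndex (ΔConj (ker R ρ) M)
    ΔConj-finite = ΔConj-finiteIndex (ker-isNormalSubgroup ρ) ker-finite 0<M D

  congruence : IsCongruence (ker R ρ) → IsCongruence (kerT R ρ D)
  congruence (N , 1≤N , Γ[N]⊆ker) =
    N ℕ.* M , ℕP.*-mono-≤ 1≤N 0<M , λ γ γ∈Γ[NM] → kerT⊇ΔConj {γ} (Γ⊆ΔConj 0<M Γ[N]⊆ker γ γ∈Γ[NM])
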